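{- Let $\mathcal{R}$ be a set of atomic rules and $h\ge 0$. (i) For any instance of a logical rule of $\mathbf{G3c}$, if its conclusion has a derivation in the logic-free calculus $\mathcal{R}$ of height at most $h$, then each of its premisses has a derivation in $\mathcal{R}$ of height at most $h$. (ii) The same holds for the logical rules of $\mathbf{G3i}$ and of $\mathbf{G3m}$, with the exception of the rules $R^i\rightarrow$ and $R^i\forall$.
   Context: Formulae are first-order formulae (function symbols allowed) built from atomic formulae and $\bot$ with $\wedge,\vee,\rightarrow,\forall,\exists$; sequents $\Gamma\Rightarrow\Delta$ have finite multisets $\Gamma,\Delta$. Logical rules of $\mathbf{G3c}$: $L\wedge$: from $A,B,\Gamma\Rightarrow\Delta$ infer $A\wedge B,\Gamma\Rightarrow\Delta$; $R\wedge$: from $\Gamma\Rightarrow\Delta,A$ and $\Gamma\Rightarrow\Delta,B$ infer $\Gamma\Rightarrow\Delta,A\wedge B$; $L\vee$: from $A,\Gamma\Rightarrow\Delta$ and $B,\Gamma\Rightarrow\Delta$ infer $A\vee B,\Gamma\Rightarrow\Delta$; $R\vee$: from $\Gamma\Rightarrow\Delta,A,B$ infer $\Gamma\Rightarrow\Delta,A\vee B$; $L\rightarrow$: from $\Gamma\Rightarrow\Delta,A$ and $B,\Gamma\Rightarrow\Delta$ infer $A\rightarrow B,\Gamma\Rightarrow\Delta$; $R\rightarrow$: from $A,\Gamma\Rightarrow\Delta,B$ infer $\Gamma\Rightarrow\Delta,A\rightarrow B$; $L\bot$: $\bot,\Gamma\Rightarrow\Delta$ (no premisses); $L\forall$: from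 $A[x/t],\forall xA,\Gamma\Rightarrow\Delta$ infer $\forall xA,\Gamma\Rightarrow\Delta$; $R\forall$: from $\Gamma\Rightarrow\Delta,A[x/a]$ infer $\Gamma\Rightarrow\Delta,\forall xA$; $L\exists$: from $A[x/a],\Gamma\Rightarrow\Delta$ infer $\exists xA,\Gamma\Rightarrow\Delta$; $R\exists$: from $\Gamma\Rightarrow\Delta,\exists xA,A[x/t]$ infer $\Gamma\Rightarrow\Delta,\exists xA$; in $L\exists,R\forall$ the parameter $a$ does not occur in the conclusion. $\mathbf{G3i}$ is obtained by replacing $L\rightarrow,R\rightarrow,R\forall$ with $L^i\rightarrow$: from $A\rightarrow B,\Gamma\Rightarrow\Delta,A$ and $B,\Gamma\Rightarrow\Delta$ infer $A\rightarrow B,\Gamma\Rightarrow\Delta$; $R^i\rightarrow$: from $A,\Gamma\Rightarrow B$ infer $\Gamma\Rightarrow\Delta,A\rightarrow B$; $R^i\forall$: from $\Gamma\Rightarrow A[x/a]$ infer $\Gamma\Rightarrow\Delta,\forall xA$ ($a$ not in the conclusion). $\mathbf{G3m}$ is $\mathbf{G3i}$ with $L\bot$ replaced by initial sequents $\bot,\Gamma\Rightarrow\Delta,\bot$. An atomic rule has the form: from $\vec{Q_i},\Gamma_i\Rightarrow\Delta_i,\vec{Q_i'}$ ($i=1,\dots,n$) infer $\vec{P},\Gamma_1,\dots,\Gamma_n\Rightarrow\Delta_1,\dots,\Delta_n,\vec{P'}$, with $\vec{Q_i},\vec{Q_i'},\vec P,\vec{P'}$ possibly empty sequences of atomic formulae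 and $\Gamma_i,\Delta_i$ arbitrary contexts. For a set $\mathcal{R}$ of atomic rules, the logic-free calculus $\mathcal{R}$ has initial sequents $P,\Gamma\Rightarrow\Delta,P$ ($P$ atomic) and the rules of $\mathcal{R}$ only. Height of a derivation = maximal number of inferences on a branch. -}

module Defs where

open import Data.Nat using (ℕ; zero; suc; _≡ᵇ_)
open import Data.Bool using (Bool; true; false; if_then_else_; _∨_)
open import Data.List using (List; []; _∷_; _++_; map; concatMap; zipWith; length)
open import Data.Product using (_×_; _,_; proj₁; proj₂)
open import Data.List.Relation.Unary.All using (All)
open import Data.List.Relation.Binary.Permutation.Propositional using (_↭_)
open import Relation.Binary.PropositionalEquality using (_≡_)

-- Syntax.  Bound variables x (names ℕ) and free parameters a (names ℕ)
-- are distinct syntactic categories (Negri–von Plato convention).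

-- Terms that may be substituted: built from parameters and function
-- symbols only (no variables), so substitution is capture-free.
data GTerm : Set where
  gpar : ℕ → GTerm
  gfn  : ℕ → List GTerm → GTerm

data Tm : Set where
  var : ℕ → Tm
  par : ℕ → Tm
  fn  : ℕ → List Tm → Tm

record Atom : Set where
  constructor _⟨_⟩
  field
    pred : ℕ
    args : List Tm

infixr 9 _∧'_
infixr 8 _∨'_
infixr 7 _⊃_

data Formula : Set where
  atom  : Atom → Formula
  ⊥'    : Formula
  _∧'_  : Formula → Formula → Formula
  _∨'_  : Formula → Formula → Formula
  _⊃_   : Formula → Formula → Formula
  ∀'    : ℕ → Formula → Formula
  ∃'    : ℕ → Formula → Formula

mutual
  embed : GTerm → Tm
  embed (gpar a)    = par a
  embed (gfn f ts)  = fn f (embeds ts)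

  embeds : List GTerm → List Tm
  embeds []       = []
  embeds (t ∷ ts) = embed t ∷ embeds ts

mutual
  substT : ℕ → GTerm → Tm → Tm
  substT x t (var y)   = if x ≡ᵇ y then embed t else var y
  substT x t (par a)   = par a
  substT x t (fn f us) = fn f (substTs x t us)

  substTs : ℕ → GTerm → List Tm → List Tm
  substTs x t []       = []
  substTs x t (u ∷ us) = substT x t u ∷ substTs x t us

_[_/_] : Formula → ℕ → GTerm → Formula
atom (P ⟨ us ⟩) [ x / t ] = atom (P ⟨ substTs x t us ⟩)
⊥'         [ x / t ] = ⊥'
(A ∧' B)   [ x / t ] = (A [ x / t ]) ∧' (B [ x / t ])
(A ∨' B)   [ x / t ] = (A [ x / t ]) ∨' (B [ x / t ])
(A ⊃ B)    [ x / t ] = (A [ x / t ]) ⊃ (B [ x / t ])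
∀' y A     [ x / t ] = if x ≡ᵇ y then ∀' y A else ∀' y (A [ x / t ])
∃' y A     [ x / t ] = if x ≡ᵇ y then ∃' y A else ∃' y (A [ x / t ])

mutual
  occT : ℕ → Tm → Bool
  occT a (var y)   = false
  occT a (par b)   = a ≡ᵇ b
  occT a (fn f us) = occTs a us

  occTs : ℕ → List Tm → Bool
  occTs a []       = false
  occTs a (u ∷ us) = occT a u ∨ occTs a us

occF : ℕ → Formula → Bool
occF a (atom (P ⟨ us ⟩)) = occTs a us
occF a ⊥'       = false
occF a (A ∧' B) = occF a A ∨ occF a B
occF a (A ∨' B) = occF a A ∨ occF a B
occF a (A ⊃ B)  = occF a A ∨ occF a B
occF a (∀' y A) = occF a A
occF a (∃' y A) = occF a A

occL : ℕ → List Formula → Bool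
occL a []       = false
occL a (A ∷ Γ)  = occF a A ∨ occL a Γ

-- Sequents Γ ⇒ Δ.  Γ, Δ are multisets, represented by lists; every
-- notion below is invariant under permutation (the logic-free calculus
-- is defined up to _↭_).

infix 3 _⇒_
infix 10 _[_/_]
record Seq : Set where
  constructor _⇒_
  field
    ante : List Formula
    succ : List Formula

Fresh : ℕ → Seq → Set
Fresh a (Γ ⇒ Δ) = (occL a Γ ∨ occL a Δ) ≡ false

-- Atomic rules:
--   Q⃗₁,Γ₁ ⇒ Δ₁,Q⃗₁' … Q⃗ₙ,Γₙ ⇒ Δₙ,Q⃗ₙ'  /  P⃗,Γ₁…Γₙ ⇒ Δ₁…Δₙ,P⃗'
-- A rule (scheme) is given by its set of atomic shapes; the contexts
-- are arbitrary and supplied at each instance.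

record AtomicRule : Set where
  field
    prems : List (List Atom × List Atom)
    P     : List Atom
    P'    : List Atom
open AtomicRule public

atoms : List Atom → List Formula
atoms = map atom

instPrems : List (List Atom × List Atom) → List (List Formula × List Formula) → List Seq
instPrems = zipWith (λ q c → (atoms (proj₁ q) ++ proj₁ c) ⇒ (proj₂ c ++ atoms (proj₂ q)))

-- Der R h S : S has a derivation of height at most h in the logic-free
-- calculus R (initial sequents P,Γ ⇒ Δ,P with P atomic + rules of R).
data Der (R : AtomicRule → Set) : ℕ → Seq → Set where
  init : ∀ {h Γ Δ Γ' Δ'} (P : Atom) →
         Γ ↭ atom P ∷ Γ' → Δ ↭ atom P ∷ Δ' → Der R h (Γ ⇒ Δ)
  rule : ∀ {h Γ Δ} (r : AtomicRule) → R r →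
         (ctxs : List (List Formula × List Formula)) →
         length ctxs ≡ length (prems r) →
         All (Der R h) (instPrems (prems r) ctxs) →
         Γ ↭ atoms (P r) ++ concatMap proj₁ ctxs →
         Δ ↭ concatMap proj₂ ctxs ++ atoms (P' r) →
         Der R (suc h) (Γ ⇒ Δ)

-- Instances of logical rules: G3c r ps c  means  ps / c  is an instance
-- (ps = list of premisses, c = conclusion).  Active formulae are written
-- at the head of the lists (multisets).

data G3c : List Seq → Seq → Set where
  L∧ : ∀ A B Γ Δ → G3c ((A ∷ B ∷ Γ ⇒ Δ) ∷ []) (A ∧' B ∷ Γ ⇒ Δ)
  R∧ : ∀ A B Γ Δ → G3c ((Γ ⇒ A ∷ Δ) ∷ (Γ ⇒ B ∷ Δ) ∷ []) (Γ ⇒ A ∧' B ∷ Δ)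
  L∨ : ∀ A B Γ Δ → G3c ((A ∷ Γ ⇒ Δ) ∷ (B ∷ Γ ⇒ Δ) ∷ []) (A ∨' B ∷ Γ ⇒ Δ)
  R∨ : ∀ A B Γ Δ → G3c ((Γ ⇒ A ∷ B ∷ Δ) ∷ []) (Γ ⇒ A ∨' B ∷ Δ)
  L⊃ : ∀ A B Γ Δ → G3c ((Γ ⇒ A ∷ Δ) ∷ (B ∷ Γ ⇒ Δ) ∷ []) (A ⊃ B ∷ Γ ⇒ Δ)
  R⊃ : ∀ A B Γ Δ → G3c ((A ∷ Γ ⇒ B ∷ Δ) ∷ []) (Γ ⇒ A ⊃ B ∷ Δ)
  L⊥ : ∀ Γ Δ → G3c [] (⊥' ∷ Γ ⇒ Δ)
  L∀ : ∀ x A (t : GTerm) Γ Δ →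
       G3c ((A [ x / t ] ∷ ∀' x A ∷ Γ ⇒ Δ) ∷ []) (∀' x A ∷ Γ ⇒ Δ)
  R∀ : ∀ x A (a : ℕ) Γ Δ → Fresh a (Γ ⇒ ∀' x A ∷ Δ) →
       G3c ((Γ ⇒ A [ x / gpar a ] ∷ Δ) ∷ []) (Γ ⇒ ∀' x A ∷ Δ)
  L∃ : ∀ x A (a : ℕ) Γ Δ → Fresh a (∃' x A ∷ Γ ⇒ Δ) →
       G3c ((A [ x / gpar a ] ∷ Γ ⇒ Δ) ∷ []) (∃' x A ∷ Γ ⇒ Δ)
  R∃ : ∀ x A (t : GTerm) Γ Δ →
       G3c ((Γ ⇒ ∃' x A ∷ A [ x / t ] ∷ Δ) ∷ []) (Γ ⇒ ∃' x A ∷ Δ)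

-- G3i and G3m share all logical rules except the treatment of ⊥.
data Variant : Set where
  G3i G3m : Variant

data Int : Variant → List Seq → Seq → Set where
  L∧  : ∀ {v} A B Γ Δ → Int v ((A ∷ B ∷ Γ ⇒ Δ) ∷ []) (A ∧' B ∷ Γ ⇒ Δ)
  R∧  : ∀ {v} A B Γ Δ → Int v ((Γ ⇒ A ∷ Δ) ∷ (Γ ⇒ B ∷ Δ) ∷ []) (Γ ⇒ A ∧' B ∷ Δ)
  L∨  : ∀ {v} A B Γ Δ → Int v ((A ∷ Γ ⇒ Δ) ∷ (B ∷ Γ ⇒ Δ) ∷ []) (A ∨' B ∷ Γ ⇒ Δ)
  R∨  : ∀ {v} A B Γ Δ → Int v ((Γ ⇒ A ∷ B ∷ Δ) ∷ []) (Γ ⇒ A ∨' B ∷ Δ)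
  Li⊃ : ∀ {v} A B Γ Δ →
        Int v ((A ⊃ B ∷ Γ ⇒ A ∷ Δ) ∷ (B ∷ Γ ⇒ Δ) ∷ []) (A ⊃ B ∷ Γ ⇒ Δ)
  Ri⊃ : ∀ {v} A B Γ Δ → Int v ((A ∷ Γ ⇒ B ∷ []) ∷ []) (Γ ⇒ A ⊃ B ∷ Δ)
  L⊥  : ∀ Γ Δ → Int G3i [] (⊥' ∷ Γ ⇒ Δ)
  init⊥ : ∀ Γ Δ → Int G3m [] (⊥' ∷ Γ ⇒ ⊥' ∷ Δ)
  L∀  : ∀ {v} x A (t : GTerm) Γ Δ →
        Int v ((A [ x / t ] ∷ ∀' x A ∷ Γ ⇒ Δ) ∷ []) (∀' x A ∷ Γ ⇒ Δ)
  Ri∀ : ∀ {v} x A (a : ℕ) Γ Δ → Fresh a (Γ ⇒ ∀' x A ∷ Δ) →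
        Int v ((Γ ⇒ A [ x / gpar a ] ∷ []) ∷ []) (Γ ⇒ ∀' x A ∷ Δ)
  L∃  : ∀ {v} x A (a : ℕ) Γ Δ → Fresh a (∃' x A ∷ Γ ⇒ Δ) →
        Int v ((A [ x / gpar a ] ∷ Γ ⇒ Δ) ∷ []) (∃' x A ∷ Γ ⇒ Δ)
  R∃  : ∀ {v} x A (t : GTerm) Γ Δ →
        Int v ((Γ ⇒ ∃' x A ∷ A [ x / t ] ∷ Δ) ∷ []) (Γ ⇒ ∃' x A ∷ Δ)

data Excepted {v} : ∀ {ps c} → Int v ps c → Set where
  ri⊃ : ∀ {A B Γ Δ} → Excepted (Ri⊃ A B Γ Δ)
  ri∀ : ∀ {x A a Γ Δ} {fr : Fresh a (Γ ⇒ ∀' x A ∷ Δ)} → Excepted (Ri∀ x A a Γ Δ fr)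

module Submission where

-- In a logic-free derivation every principal formula is atomic, so a compound
-- formula of the conclusion lies in the contexts and is passed up to one premiss
-- and eventually to an initial sequent, where again it is not the principal atom.
-- Hence it can be replaced, without increasing the height, by arbitrary X on the
-- left and Y on the right; each premiss of a logical rule other than R^i→, R^i∀
-- is its conclusion with the principal formula so replaced. The succedent case is
-- the antecedent case for the calculus with every atomic rule mirrored.

open import Defs
open import Data.Nat using (ℕ; suc)
open import Data.Nat.Properties using (suc-injective)
open import Data.List using (List; []; _∷_; _++_; map; concat; concatMap; length)
open import Data.List.Properties using (map-∘; map-id; length-map)
open import Data.Product using (_×_; _,_; proj₁; proj₂; ∃; swap)
open import Data.Sum using (inj₁; inj₂)
open import Data.Empty using (⊥-elim)
open import Data.List.Relation.Unary.All using (All; []; _∷_)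
open import Data.List.Relation.Unary.Any using (here; there)
open import Data.List.Membership.Propositional using (_∈_; _∉_)
open import Data.List.Membership.Propositional.Properties using (∈-++⁻; ∈-∃++)
open import Data.List.Relation.Binary.Permutation.Propositional
  using (_↭_; ↭-refl; ↭-sym; ↭-trans; ↭-reflexive; module PermutationReasoning)
open import Data.List.Relation.Binary.Permutation.Propositional.Properties
  using (∈-resp-↭; ++⁺ˡ; ++⁺ʳ; shift; shifts; drop-∷; ++-comm; ++-assoc)
open import Relation.Nullary using (¬_)
open import Relation.Binary.PropositionalEquality
  using (_≡_; _≢_; refl; sym; trans; cong; subst)

∈⇒↭-∷ : ∀ {A : Set} {x : A} {xs} → x ∈ xs → ∃ λ ys → xs ↭ x ∷ ys
∈⇒↭-∷ {x = x} x∈xs with ∈-∃++ x∈xs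
... | ys , zs , refl = ys ++ zs , shift x ys zs

↭-∷-under-++ : ∀ {A : Set} (X : List A) {x xs ys} → xs ↭ x ∷ ys → X ++ xs ↭ x ∷ X ++ ys
↭-∷-under-++ X {x} {ys = ys} p = ↭-trans (++⁺ˡ X p) (shift x X ys)

NonAtomic : Formula → Set
NonAtomic F = ∀ P → F ≢ atom P

∉-atoms : ∀ {F} → NonAtomic F → (Ps : List Atom) → F ∉ atoms Ps
∉-atoms F≢ (P ∷ Ps) (here F≡P)  = F≢ P F≡P
∉-atoms F≢ (P ∷ Ps) (there F∈) = ∉-atoms F≢ Ps F∈

antes succs : List (List Formula × List Formula) → List Formula
antes = concatMap proj₁
succs = concatMap proj₂

Der-resp-↭ : ∀ {R h Γ Δ Γ' Δ'} → Der R h (Γ ⇒ Δ) → Γ ↭ Γ' → Δ ↭ Δ' → Der R h (Γ' ⇒ Δ')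
Der-resp-↭ (init P p q) Γ↭ Δ↭ = init P (↭-trans (↭-sym Γ↭) p) (↭-trans (↭-sym Δ↭) q)
Der-resp-↭ (rule r x ctxs l ds p q) Γ↭ Δ↭ =
  rule r x ctxs l ds (↭-trans (↭-sym Γ↭) p) (↭-trans (↭-sym Δ↭) q)

record ContextsReplaced (R : AtomicRule → Set) (h : ℕ) (qs : List (List Atom × List Atom))
       (ctxs : List (List Formula × List Formula)) (F : Formula) (X Y : List Formula) : Set where
  field
    ctxs'          : List (List Formula × List Formula)
    length-ctxs'   : length ctxs' ≡ length qs
    derivations    : All (Der R h) (instPrems qs ctxs')
    rest           : List Formula
    antes-removed  : antes ctxs ↭ F ∷ rest
    antes-replaced : antes ctxs' ↭ X ++ rest
    succs-extended : succs ctxs' ↭ Y ++ succs ctxs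

module _ {R : AtomicRule → Set} where

  open PermutationReasoning

  mutual
    replaceˡ : ∀ {h F Γ Δ Γ₀} → NonAtomic F → Der R h (Γ ⇒ Δ) → Γ ↭ F ∷ Γ₀ →
               ∀ X Y → Der R h (X ++ Γ₀ ⇒ Y ++ Δ)
    replaceˡ F≢ (init P p q) Γ↭ X Y with ∈-resp-↭ (↭-trans (↭-sym p) Γ↭) (here refl)
    ... | here F≡P  = ⊥-elim (F≢ P (sym F≡P))
    ... | there P∈ with ∈⇒↭-∷ P∈
    ... | _ , Γ₀↭ = init P (↭-∷-under-++ X Γ₀↭) (↭-∷-under-++ Y q)
    replaceˡ {F = F} {Δ = Δ} {Γ₀} F≢ (rule r x ctxs l ds p q) Γ↭ X Y
      with ∈-++⁻ (atoms (P r)) (∈-resp-↭ (↭-trans (↭-sym Γ↭) p) (here refl))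
    ... | inj₁ F∈P = ⊥-elim (∉-atoms F≢ (P r) F∈P)
    ... | inj₂ F∈ = rule r x ctxs' length-ctxs' derivations ante succ
      where
      open ContextsReplaced (replaceˡ-prems F≢ (prems r) ctxs l ds F∈ X Y)

      Γ₀↭ : Γ₀ ↭ atoms (P r) ++ rest
      Γ₀↭ = drop-∷ (↭-trans (↭-sym Γ↭) (↭-trans p (↭-∷-under-++ (atoms (P r)) antes-removed)))

      ante : X ++ Γ₀ ↭ atoms (P r) ++ antes ctxs'
      ante = begin
        X ++ Γ₀                      ↭⟨ ++⁺ˡ X Γ₀↭ ⟩
        X ++ atoms (P r) ++ rest     ↭⟨ shifts X (atoms (P r)) ⟩
        atoms (P r) ++ X ++ rest     ↭⟨ ++⁺ˡ (atoms (P r)) antes-replaced ⟨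
        atoms (P r) ++ antes ctxs'   ∎

      succ : Y ++ Δ ↭ succs ctxs' ++ atoms (P' r)
      succ = begin
        Y ++ Δ                              ↭⟨ ++⁺ˡ Y q ⟩
        Y ++ succs ctxs ++ atoms (P' r)     ↭⟨ ++-assoc Y (succs ctxs) (atoms (P' r)) ⟨
        (Y ++ succs ctxs) ++ atoms (P' r)   ↭⟨ ++⁺ʳ (atoms (P' r)) succs-extended ⟨
        succs ctxs' ++ atoms (P' r)         ∎

    replaceˡ-prems : ∀ {h F} → NonAtomic F → (qs : List (List Atom × List Atom))
                     (ctxs : List (List Formula × List Formula)) →
                     length ctxs ≡ length qs → All (Der R h) (instPrems qs ctxs) →
                     F ∈ antes ctxs → ∀ X Y → ContextsReplaced R h qs ctxs F X Y
    replaceˡ-prems F≢ qs [] l ds () X Y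
    replaceˡ-prems F≢ ((Q , Q') ∷ qs) ((Γ₁ , Δ₁) ∷ ctxs) l (d ∷ ds) F∈ X Y
      with ∈-++⁻ Γ₁ F∈
    ... | inj₁ F∈Γ₁ with ∈⇒↭-∷ F∈Γ₁
    ... | G₁ , Γ₁↭ = record
      { ctxs'          = (X ++ G₁ , Y ++ Δ₁) ∷ ctxs
      ; length-ctxs'   = l
      ; derivations    = Der-resp-↭ d' (shifts X (atoms Q)) (↭-sym (++-assoc Y Δ₁ (atoms Q'))) ∷ ds
      ; rest           = G₁ ++ antes ctxs
      ; antes-removed  = ++⁺ʳ (antes ctxs) Γ₁↭
      ; antes-replaced = ++-assoc X G₁ (antes ctxs)
      ; succs-extended = ++-assoc Y Δ₁ (succs ctxs)
      }
      where
      d' : Der R _ (X ++ atoms Q ++ G₁ ⇒ Y ++ Δ₁ ++ atoms Q')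
      d' = replaceˡ F≢ d (↭-∷-under-++ (atoms Q) Γ₁↭) X Y
    replaceˡ-prems F≢ ((Q , Q') ∷ qs) ((Γ₁ , Δ₁) ∷ ctxs) l (d ∷ ds) F∈ X Y
      | inj₂ F∈ctxs = record
      { ctxs'          = (Γ₁ , Δ₁) ∷ ctxs'
      ; length-ctxs'   = cong suc length-ctxs'
      ; derivations    = d ∷ derivations
      ; rest           = Γ₁ ++ rest
      ; antes-removed  = ↭-∷-under-++ Γ₁ antes-removed
      ; antes-replaced = ↭-trans (++⁺ˡ Γ₁ antes-replaced) (shifts Γ₁ X)
      ; succs-extended = ↭-trans (++⁺ˡ Δ₁ succs-extended) (shifts Δ₁ Y)
      }
      where
      open ContextsReplaced (replaceˡ-prems F≢ qs ctxs (suc-injective l) ds F∈ctxs X Y)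

dualRule : AtomicRule → AtomicRule
dualRule r = record { prems = map swap (prems r) ; P = P' r ; P' = P r }

dualRule-involutive : ∀ r → dualRule (dualRule r) ≡ r
dualRule-involutive r =
  cong (λ qs → record r { prems = qs }) (trans (sym (map-∘ (prems r))) (map-id (prems r)))

antes-swap : ∀ ctxs → antes (map swap ctxs) ≡ succs ctxs
antes-swap ctxs = cong concat (sym (map-∘ ctxs))

succs-swap : ∀ ctxs → succs (map swap ctxs) ≡ antes ctxs
succs-swap ctxs = cong concat (sym (map-∘ ctxs))

module _ {R R' : AtomicRule → Set} (dual-closed : ∀ r → R r → R' (dualRule r)) where

  mutual
    dualize : ∀ {h Γ Δ} → Der R h (Γ ⇒ Δ) → Der R' h (Δ ⇒ Γ)
    dualize (init P p q) = init P q p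
    dualize (rule r x ctxs l ds p q) =
      rule (dualRule r) (dual-closed r x) (map swap ctxs)
        (trans (length-map swap ctxs) (trans l (sym (length-map swap (prems r)))))
        (dualize-prems (prems r) ctxs ds)
        (↭-trans q (↭-trans (++-comm (succs ctxs) (atoms (P' r)))
          (↭-reflexive (cong (atoms (P' r) ++_) (sym (antes-swap ctxs))))))
        (↭-trans p (↭-trans (++-comm (atoms (P r)) (antes ctxs))
          (↭-reflexive (cong (_++ atoms (P r)) (sym (succs-swap ctxs))))))

    dualize-prems : ∀ {h} qs ctxs → All (Der R h) (instPrems qs ctxs) →
                    All (Der R' h) (instPrems (map swap qs) (map swap ctxs))
    dualize-prems [] ctxs [] = []
    dualize-prems (q ∷ qs) [] [] = []
    dualize-prems ((Q , Q') ∷ qs) ((Γ , Δ) ∷ ctxs) (d ∷ ds) =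
      Der-resp-↭ (dualize d) (++-comm Δ (atoms Q')) (++-comm (atoms Q) Γ)
      ∷ dualize-prems qs ctxs ds

module _ {R : AtomicRule → Set} where

  replaceʳ : ∀ {h F Γ Δ Δ₀} → NonAtomic F → Der R h (Γ ⇒ Δ) → Δ ↭ F ∷ Δ₀ →
             ∀ X Y → Der R h (X ++ Γ ⇒ Y ++ Δ₀)
  replaceʳ F≢ d Δ↭ X Y =
    dualize (λ _ x → x)
      (replaceˡ {R = λ r → R (dualRule r)} F≢ (dualize to-dual d) Δ↭ Y X)
    where
    to-dual : ∀ r → R r → R (dualRule (dualRule r))
    to-dual r = subst R (sym (dualRule-involutive r))

  replaceˡ-head : ∀ {h F Γ Δ} → NonAtomic F → Der R h (F ∷ Γ ⇒ Δ) →
                  ∀ X Y → Der R h (X ++ Γ ⇒ Y ++ Δ)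
  replaceˡ-head F≢ d = replaceˡ F≢ d ↭-refl

  replaceʳ-head : ∀ {h F Γ Δ} → NonAtomic F → Der R h (Γ ⇒ F ∷ Δ) →
                  ∀ X Y → Der R h (X ++ Γ ⇒ Y ++ Δ)
  replaceʳ-head F≢ d = replaceʳ F≢ d ↭-refl

module _ {R : AtomicRule → Set} {h : ℕ} where

  G3c-inversion : ∀ {ps c} → G3c ps c → Der R h c → All (Der R h) ps
  G3c-inversion (L∧ A B Γ Δ) d = replaceˡ-head (λ _ ()) d (A ∷ B ∷ []) [] ∷ []
  G3c-inversion (R∧ A B Γ Δ) d =
    replaceʳ-head (λ _ ()) d [] (A ∷ []) ∷ replaceʳ-head (λ _ ()) d [] (B ∷ []) ∷ []
  G3c-inversion (L∨ A B Γ Δ) d =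
    replaceˡ-head (λ _ ()) d (A ∷ []) [] ∷ replaceˡ-head (λ _ ()) d (B ∷ []) [] ∷ []
  G3c-inversion (R∨ A B Γ Δ) d = replaceʳ-head (λ _ ()) d [] (A ∷ B ∷ []) ∷ []
  G3c-inversion (L⊃ A B Γ Δ) d =
    replaceˡ-head (λ _ ()) d [] (A ∷ []) ∷ replaceˡ-head (λ _ ()) d (B ∷ []) [] ∷ []
  G3c-inversion (R⊃ A B Γ Δ) d = replaceʳ-head (λ _ ()) d (A ∷ []) (B ∷ []) ∷ []
  G3c-inversion (L⊥ Γ Δ) d = []
  G3c-inversion (L∀ x A t Γ Δ) d = replaceˡ-head (λ _ ()) d (A [ x / t ] ∷ ∀' x A ∷ []) [] ∷ []
  G3c-inversion (R∀ x A a Γ Δ _) d = replaceʳ-head (λ _ ()) d [] (A [ x / gpar a ] ∷ []) ∷ []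
  G3c-inversion (L∃ x A a Γ Δ _) d = replaceˡ-head (λ _ ()) d (A [ x / gpar a ] ∷ []) [] ∷ []
  G3c-inversion (R∃ x A t Γ Δ) d = replaceʳ-head (λ _ ()) d [] (∃' x A ∷ A [ x / t ] ∷ []) ∷ []

  -- The excepted rules drop the side formulae Δ, which replacement cannot do.
  Int-inversion : ∀ {v ps c} (ρ : Int v ps c) → ¬ Excepted ρ → Der R h c → All (Der R h) ps
  Int-inversion (L∧ A B Γ Δ) _ d = G3c-inversion (L∧ A B Γ Δ) d
  Int-inversion (R∧ A B Γ Δ) _ d = G3c-inversion (R∧ A B Γ Δ) d
  Int-inversion (L∨ A B Γ Δ) _ d = G3c-inversion (L∨ A B Γ Δ) d
  Int-inversion (R∨ A B Γ Δ) _ d = G3c-inversion (R∨ A B Γ Δ) d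
  Int-inversion (Li⊃ A B Γ Δ) _ d =
    replaceˡ-head (λ _ ()) d (A ⊃ B ∷ []) (A ∷ []) ∷ replaceˡ-head (λ _ ()) d (B ∷ []) [] ∷ []
  Int-inversion (Ri⊃ A B Γ Δ) ¬exc d = ⊥-elim (¬exc ri⊃)
  Int-inversion (L⊥ Γ Δ) _ d = []
  Int-inversion (init⊥ Γ Δ) _ d = []
  Int-inversion (L∀ x A t Γ Δ) _ d = G3c-inversion (L∀ x A t Γ Δ) d
  Int-inversion (Ri∀ x A a Γ Δ _) ¬exc d = ⊥-elim (¬exc ri∀)
  Int-inversion (L∃ x A a Γ Δ fr) _ d = G3c-inversion (L∃ x A a Γ Δ fr) d
  Int-inversion (R∃ x A t Γ Δ) _ d = G3c-inversion (R∃ x A t Γ Δ) d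

lemma2 : ((R : AtomicRule → Set) (h : ℕ) {ps : List Seq} {c : Seq} →
            G3c ps c → Der R h c → All (Der R h) ps)
         × ((v : Variant) (R : AtomicRule → Set) (h : ℕ) {ps : List Seq} {c : Seq} →
            (ρ : Int v ps c) → ¬ Excepted ρ → Der R h c → All (Der R h) ps)
lemma2 = (λ R h → G3c-inversion) , (λ v R h → Int-inversion)
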